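{- Let $G_1\subsetneq G_2\subsetneq\dots\subsetneq G_r$ be a sequence of distinct graphs on a common finite vertex set, each contained in the next (as edge sets). Then there exists $A\subseteq\{1,2,\dots,r\}$ with $|A|\ge r/20$ such that for all $i,j\in A$ with $i<j$, the edge set $G_j\setminus G_i$ is not a clique.
   Context: Graphs are simple graphs on a common vertex set, identified with their edge sets; $G\subset H$ means the edge set of $G$ is contained in that of $H$, and $H\setminus G$ denotes the set of edges of $H$ not in $G$. A set of edges $E$ is called a clique if there is a set $S$ of at least two vertices such that $E$ is exactly the set of all pairs of distinct vertices of $S$. -}

module Defs where

open import Data.Nat using (ℕ; _≤_; _*_; _<_)
open import Data.Bool using (Bool; true; false; _∧_; not)
open import Data.Fin using (Fin; toℕ)
open import Data.Fin.Subset using (Subset; _∈_; ∣_∣)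
open import Data.Product using (Σ; _×_; ∃)
open import Relation.Binary.PropositionalEquality using (_≡_; _≢_)
open import Relation.Nullary using (¬_)
open import Function.Bundles using (_⇔_)

record Graph (n : ℕ) : Set where
  field
    adj    : Fin n → Fin n → Bool
    sym    : ∀ u v → adj u v ≡ adj v u
    irrefl : ∀ u → adj u u ≡ false
open Graph public

-- An edge set on Fin n (a symmetric Boolean relation; only pairs u ≢ v matter).
EdgeSet : ℕ → Set
EdgeSet n = Fin n → Fin n → Bool

_⊆ᴳ_ : ∀ {n} → Graph n → Graph n → Set
G ⊆ᴳ H = ∀ u v → adj G u v ≡ true → adj H u v ≡ true

SameEdges : ∀ {n} → Graph n → Graph n → Set
SameEdges G H = ∀ u v → adj G u v ≡ adj H u v

_⊊ᴳ_ : ∀ {n} → Graph n → Graph n → Set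
G ⊊ᴳ H = (G ⊆ᴳ H) × ¬ SameEdges G H

_∖ᴳ_ : ∀ {n} → Graph n → Graph n → EdgeSet n
(H ∖ᴳ G) u v = adj H u v ∧ not (adj G u v)

IsClique : ∀ {n} → EdgeSet n → Set
IsClique {n} E = Σ (Subset n) λ S →
  (2 ≤ ∣ S ∣) × (∀ u v → u ≢ v → ((E u v ≡ true) ⇔ (u ∈ S × v ∈ S)))

-- Call i < j linked when G_j ∖ G_i is a clique. Intersecting the vertex sets of two such
-- cliques shows that links are closed under crossing (for i < j < k < l, links i–k and j–l
-- force j–k), while the three links i–k, i–l, j–l cannot occur together. Hence, inside any
-- set Y of indices, the pairs a < b of consecutive in-neighbours of a common j form a
-- non-crossing family of arcs, each determining its j. Every such arc is the longest one
-- leaving a or the longest one entering b, so there are at most 2|Y| of them, and Y spans at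
-- most 3|Y| links. Every Y therefore has a vertex of degree at most 6, and greedily keeping
-- such a vertex while discarding its neighbours yields at least r/7 pairwise unlinked indices.

module Submission where

open import Defs hiding (sym)
open import Data.Bool using (Bool; true; false; _∧_; not; if_then_else_)
open import Data.Bool.Properties using (not-¬) renaming (_≟_ to _≟ᵇ_)
open import Data.Empty using (⊥; ⊥-elim)
open import Data.Fin using (Fin; zero; suc; toℕ; inject₁; _<_; _≤_)
open import Data.Fin.Properties
  using (any?; all?; ¬∀⟶∃¬; _≟_; _<?_; <-cmp; suc-injective; toℕ-injective; toℕ-inject₁; <⇒≤pred)
  renaming (<-trans to <-transᶠ; <-irrefl to <-irreflᶠ)
open import Data.Fin.Subset
  using (Subset; ⊤; _∈_; _∉_; _⊆_; _⊂_; _∪_; _∩_; ⁅_⁆; ∣_∣; Nonempty; inside; outside)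
  renaming (⊥ to ∅)
open import Data.Fin.Subset.Induction using (⊂-wellFounded)
open import Data.Fin.Subset.Properties
  using (_∈?_; nonempty?; anySubset?; ∉⊥; Empty-unique; ∣⊥∣≡0; ∣⊤∣≡n; ∣⁅x⁆∣≡1; x∈⁅x⁆; x∈⁅y⁆⇒x≡y;
         x∈p∪q⁺; x∈p∪q⁻; x∈p∩q⁺; x∈p∩q⁻; x∈p∧x≢y⇒x∈p-y; x∈p⇒∣p-x∣<∣p∣)
import Data.Nat as ℕ
open ℕ using (ℕ; zero; suc; _+_; _*_; z≤n; s≤s)
import Data.Nat.Properties as ℕ
open import Algebra.Properties.Semiring.Sum ℕ.+-*-semiring
  using (sum; sum-syntax; sum-remove; sum-cong-≗; ∑-distrib-+; ∑-comm; *-distribˡ-sum)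
open import Data.Product using (Σ; _×_; _,_; proj₁; proj₂; ∃; ∃-syntax; ∄-syntax)
open import Data.Sum using (_⊎_; inj₁; inj₂)
open import Data.Vec using (_∷_; []; tabulate)
open import Data.Vec.Properties using (lookup∘tabulate; []=⇒lookup; lookup⇒[]=)
open import Function using (_∘′_)
open import Function.Bundles using (_⇔_; mk⇔; Equivalence)
open import Induction.WellFounded using (Acc; acc)
open import Level using (Level; 0ℓ)
open import Relation.Binary using (Rel; Reflexive; Transitive; tri<; tri≈; tri>)
  renaming (Decidable to Decidable₂)
open import Relation.Binary.PropositionalEquality
  using (_≡_; _≢_; refl; sym; trans; cong; cong₂; subst; module ≡-Reasoning)
open import Relation.Nullary using (¬_; Dec; yes; no; does)
open import Relation.Nullary.Decidable using (_×-dec_; _⊎-dec_; _→-dec_; ¬?; map′; dec-true)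
open import Relation.Unary using (Pred; Decidable)

private variable
  ℓ ℓ′ ℓ″ : Level
  n : ℕ
  A B : Set ℓ

χ : Dec A → ℕ
χ a? = if does a? then 1 else 0

χ-yes : (a? : Dec A) → A → χ a? ≡ 1
χ-yes (yes _) _ = refl
χ-yes (no ¬a) a = ⊥-elim (¬a a)

χ-no : (a? : Dec A) → ¬ A → χ a? ≡ 0
χ-no (yes a) ¬a = ⊥-elim (¬a a)
χ-no (no _)  _  = refl

χ-mono : (A → B) → (a? : Dec A) (b? : Dec B) → χ a? ℕ.≤ χ b?
χ-mono f (yes a) b? = ℕ.≤-reflexive (sym (χ-yes b? (f a)))
χ-mono f (no _)  b? = z≤n

_⇔-dec_ : Dec A → Dec B → Dec (A ⇔ B)
a? ⇔-dec b? = map′ (λ (to , from) → mk⇔ to from) (λ A⇔B → Equivalence.to A⇔B , Equivalence.from A⇔B)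
                   ((a? →-dec b?) ×-dec (b? →-dec a?))

count : {P : Pred (Fin n) ℓ} → Decidable P → ℕ
count {n = n} P? = ∑[ i < n ] χ (P? i)

∑-mono-≤ : (f g : Fin n → ℕ) → (∀ i → f i ℕ.≤ g i) → ∑[ i < n ] f i ℕ.≤ ∑[ i < n ] g i
∑-mono-≤ {zero}  f g f≤g = z≤n
∑-mono-≤ {suc n} f g f≤g =
  ℕ.+-mono-≤ (f≤g zero) (∑-mono-≤ (f ∘′ suc) (g ∘′ suc) (λ i → f≤g (suc i)))

term≤∑ : (f : Fin n → ℕ) (i : Fin n) → f i ℕ.≤ ∑[ j < n ] f j
term≤∑ {suc n} f i = ℕ.≤-trans (ℕ.m≤m+n (f i) _) (ℕ.≤-reflexive (sym (sum-remove {i = i} f)))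

count-none : {P : Pred (Fin n) ℓ} (P? : Decidable P) → (∀ i → ¬ P i) → count P? ≡ 0
count-none {zero}  P? ¬P = refl
count-none {suc n} P? ¬P =
  cong₂ _+_ (χ-no (P? zero) (¬P zero)) (count-none (λ i → P? (suc i)) (λ i → ¬P (suc i)))

count-unique : {P : Pred (Fin n) ℓ} (P? : Decidable P) →
  (∀ {i j} → P i → P j → i ≡ j) → count P? ℕ.≤ 1
count-unique {zero}  P? uniq = z≤n
count-unique {suc n} P? uniq with P? zero
... | yes p₀ = ℕ.≤-reflexive (cong suc (count-none (λ i → P? (suc i)) λ i pᵢ → 0≢suc (uniq p₀ pᵢ)))
  where
  0≢suc : ∀ {i : Fin n} → ¬ (zero ≡ suc i)
  0≢suc ()
... | no _ = count-unique (λ i → P? (suc i)) (λ pᵢ pⱼ → suc-injective (uniq pᵢ pⱼ))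

∣p∣≡count : (p : Subset n) → ∣ p ∣ ≡ count (_∈? p)
∣p∣≡count []            = refl
∣p∣≡count (inside ∷ p)  = cong suc (∣p∣≡count p)
∣p∣≡count (outside ∷ p) = ∣p∣≡count p

count-unique≤χ : {P : Pred (Fin n) ℓ} (P? : Decidable P) (b? : Dec B) →
  (∀ {i} → P i → B) → (∀ {i j} → P i → P j → i ≡ j) → count P? ℕ.≤ χ b?
count-unique≤χ P? (yes _) _   uniq = count-unique P? uniq
count-unique≤χ P? (no ¬b) P⇒B _    = ℕ.≤-reflexive (count-none P? (λ i pᵢ → ¬b (P⇒B pᵢ)))

χ-⊎ : {C : Set ℓ″} → (A → B ⊎ C) → (a? : Dec A) (b? : Dec B) (c? : Dec C) → χ a? ℕ.≤ χ b? + χ c?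
χ-⊎ f (no _)  b? c? = z≤n
χ-⊎ f (yes a) b? c? with f a
... | inj₁ b = ℕ.≤-trans (ℕ.≤-reflexive (sym (χ-yes b? b))) (ℕ.m≤m+n _ _)
... | inj₂ c = ℕ.≤-trans (ℕ.≤-reflexive (sym (χ-yes c? c))) (ℕ.m≤n+m _ _)

χ-disjoint : {C : Set ℓ′} → (A → C) → (B → C) → (A → ¬ B) →
  (a? : Dec A) (b? : Dec B) (c? : Dec C) → χ a? + χ b? ℕ.≤ χ c?
χ-disjoint A⇒C B⇒C _     (no _)  b?      c? = χ-mono B⇒C b? c?
χ-disjoint A⇒C B⇒C _     (yes a) (no _)  c? = ℕ.≤-reflexive (trans (ℕ.+-identityʳ 1) (sym (χ-yes c? (A⇒C a))))
χ-disjoint A⇒C B⇒C A⇒¬B (yes a) (yes b) c? = ⊥-elim (A⇒¬B a b)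

select : {P : Pred (Fin n) ℓ} → Decidable P → Subset n
select P? = tabulate (λ i → does (P? i))

∈-select⁺ : {P : Pred (Fin n) ℓ} (P? : Decidable P) {i : Fin n} → P i → i ∈ select P?
∈-select⁺ P? {i} pᵢ = lookup⇒[]= i _ (trans (lookup∘tabulate _ i) (dec-true (P? i) pᵢ))

∈-select⁻ : {P : Pred (Fin n) ℓ} (P? : Decidable P) {i : Fin n} → i ∈ select P? → P i
∈-select⁻ P? {i} i∈ = witness (P? i) (trans (sym (lookup∘tabulate _ i)) ([]=⇒lookup i∈))
  where
  witness : (a? : Dec A) → does a? ≡ true → A
  witness (yes a) _ = a

count-⊎ : {P : Pred (Fin n) ℓ} {Q : Pred (Fin n) ℓ′} {R : Pred (Fin n) ℓ″}
  (P? : Decidable P) (Q? : Decidable Q) (R? : Decidable R) →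
  (∀ {i} → P i → Q i ⊎ R i) → count P? ℕ.≤ count Q? + count R?
count-⊎ P? Q? R? split = ℕ.≤-trans
  (∑-mono-≤ _ _ (λ i → χ-⊎ split (P? i) (Q? i) (R? i)))
  (ℕ.≤-reflexive (∑-distrib-+ (λ i → χ (Q? i)) (λ i → χ (R? i))))

count-disjoint : {P : Pred (Fin n) ℓ} {Q : Pred (Fin n) ℓ} {R : Pred (Fin n) ℓ′}
  (P? : Decidable P) (Q? : Decidable Q) (R? : Decidable R) →
  (∀ {i} → P i → R i) → (∀ {i} → Q i → R i) → (∀ {i} → P i → ¬ Q i) →
  count P? + count Q? ℕ.≤ count R?
count-disjoint P? Q? R? P⇒R Q⇒R P⇒¬Q = ℕ.≤-trans
  (ℕ.≤-reflexive (sym (∑-distrib-+ (λ i → χ (P? i)) (λ i → χ (Q? i)))))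
  (∑-mono-≤ _ _ (λ i → χ-disjoint P⇒R Q⇒R P⇒¬Q (P? i) (Q? i) (R? i)))

Nonempty⇒1≤∣p∣ : {p : Subset n} → Nonempty p → 1 ℕ.≤ ∣ p ∣
Nonempty⇒1≤∣p∣ {p = p} (x , x∈p) = begin
  1                  ≡⟨ sym (χ-yes (x ∈? p) x∈p) ⟩
  χ (x ∈? p)         ≤⟨ term≤∑ (λ y → χ (y ∈? p)) x ⟩
  count (_∈? p)      ≡⟨ sym (∣p∣≡count p) ⟩
  ∣ p ∣              ∎
  where open ℕ.≤-Reasoning

2≤∣p∣ : {p : Subset n} {x y : Fin n} → x ∈ p → y ∈ p → x ≢ y → 2 ℕ.≤ ∣ p ∣
2≤∣p∣ x∈p y∈p x≢y =
  ℕ.≤-trans (s≤s (Nonempty⇒1≤∣p∣ (_ , x∈p∧x≢y⇒x∈p-y y∈p (λ y≡x → x≢y (sym y≡x)))))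
            (x∈p⇒∣p-x∣<∣p∣ x∈p)

least : {P : Pred (Fin n) ℓ} → Decidable P → ∃ P → ∃[ m ] P m × (∀ {i} → i < m → ¬ P i)
least {suc n} P? ∃P with P? zero
... | yes p₀ = zero , p₀ , λ ()
least {suc n} P? (zero  , p₀) | no ¬p₀ = ⊥-elim (¬p₀ p₀)
least {suc n} P? (suc i , pᵢ) | no ¬p₀ with least (λ i → P? (suc i)) (i , pᵢ)
... | m , pₘ , below = suc m , pₘ , minimal
  where
  minimal : ∀ {i} → i < suc m → ¬ _
  minimal {zero}  _         = ¬p₀
  minimal {suc i} (s≤s i<m) = below i<m

χ-∃≤count : {P : Pred (Fin n) ℓ} (P? : Decidable P) → χ (any? P?) ℕ.≤ count P?
χ-∃≤count P? with any? P?
... | yes (i , pᵢ) = ℕ.≤-trans (ℕ.≤-reflexive (sym (χ-yes (P? i) pᵢ))) (term≤∑ (λ j → χ (P? j)) i)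
... | no _         = z≤n

module Degeneracy {r : ℕ} {_~_ : Rel (Fin r) ℓ} (_~?_ : Decidable₂ _~_) where

  Edge : Subset r → Rel (Fin r) ℓ
  Edge Y u v = u ∈ Y × v ∈ Y × u ~ v

  edge? : (Y : Subset r) → Decidable₂ (Edge Y)
  edge? Y u v = u ∈? Y ×-dec v ∈? Y ×-dec u ~? v

  edges : Subset r → ℕ
  edges Y = ∑[ u < r ] count (edge? Y u)

  degree : Subset r → Fin r → ℕ
  degree Y v = count (edge? Y v) + count (λ u → edge? Y u v)

  Independent : Subset r → Set ℓ
  Independent I = ∀ {u v} → u ∈ I → v ∈ I → ¬ u ~ v

  ∑degree≡2*edges : (Y : Subset r) → ∑[ v < r ] degree Y v ≡ 2 * edges Y
  ∑degree≡2*edges Y = begin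
    ∑[ v < r ] degree Y v
      ≡⟨ ∑-distrib-+ (λ v → count (edge? Y v)) (λ v → count (λ u → edge? Y u v)) ⟩
    edges Y + ∑[ v < r ] ∑[ u < r ] χ (edge? Y u v)
      ≡⟨ cong (edges Y +_) (sym (∑-comm (λ u v → χ (edge? Y u v)))) ⟩
    edges Y + edges Y
      ≡⟨ cong (edges Y +_) (sym (ℕ.+-identityʳ _)) ⟩
    2 * edges Y                                     ∎
    where open ≡-Reasoning

  sparse⇒low-degree : (c : ℕ) (Y : Subset r) → edges Y ℕ.≤ c * ∣ Y ∣ →
    Nonempty Y → ∃[ v ] v ∈ Y × degree Y v ℕ.≤ 2 * c
  sparse⇒low-degree c Y sparse nonempty with any? (λ v → v ∈? Y ×-dec degree Y v ℕ.≤? 2 * c)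
  ... | yes low = low
  ... | no ¬low = ⊥-elim (ℕ.<-irrefl refl
                    (ℕ.≤-trans (ℕ.+-monoˡ-≤ (2 * c * ∣ Y ∣) (Nonempty⇒1≤∣p∣ nonempty)) too-many))
    where
    high : ∀ v → suc (2 * c) * χ (v ∈? Y) ℕ.≤ degree Y v
    high v = bound (v ∈? Y)
      where
      bound : (v∈?Y : Dec (v ∈ Y)) → suc (2 * c) * χ v∈?Y ℕ.≤ degree Y v
      bound (yes v∈Y) =
        ℕ.≤-trans (ℕ.≤-reflexive (ℕ.*-identityʳ _)) (ℕ.≰⇒> (λ deg≤ → ¬low (v , v∈Y , deg≤)))
      bound (no _)    = ℕ.≤-trans (ℕ.≤-reflexive (ℕ.*-zeroʳ (suc (2 * c)))) z≤n

    too-many : suc (2 * c) * ∣ Y ∣ ℕ.≤ 2 * c * ∣ Y ∣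
    too-many = begin
      suc (2 * c) * ∣ Y ∣                      ≡⟨ cong (suc (2 * c) *_) (∣p∣≡count Y) ⟩
      suc (2 * c) * count (_∈? Y)              ≡⟨ *-distribˡ-sum (suc (2 * c)) (λ v → χ (v ∈? Y)) ⟩
      sum (λ v → suc (2 * c) * χ (v ∈? Y))     ≤⟨ ∑-mono-≤ _ _ high ⟩
      sum (degree Y)                           ≡⟨ ∑degree≡2*edges Y ⟩
      2 * edges Y                              ≤⟨ ℕ.*-monoʳ-≤ 2 sparse ⟩
      2 * (c * ∣ Y ∣)                          ≡⟨ sym (ℕ.*-assoc 2 c ∣ Y ∣) ⟩
      2 * c * ∣ Y ∣                            ∎
      where open ℕ.≤-Reasoning

  module _ (~-irrefl : ∀ {v} → ¬ v ~ v) (d : ℕ)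
           (low-degree : ∀ Y → Nonempty Y → ∃[ v ] v ∈ Y × degree Y v ℕ.≤ d) where

    LargeIndependentSubset : Subset r → Set ℓ
    LargeIndependentSubset Y = ∃[ I ] I ⊆ Y × Independent I × ∣ Y ∣ ℕ.≤ suc d * ∣ I ∣

    greedy-step : ∀ Y v → v ∈ Y → degree Y v ℕ.≤ d →
      (∀ Y′ → Y′ ⊂ Y → LargeIndependentSubset Y′) → LargeIndependentSubset Y
    greedy-step Y v v∈Y deg≤d rec = I , I⊆Y , independent , size
      where
      Near : Pred (Fin r) ℓ
      Near w = w ∈ ⁅ v ⁆ ⊎ Edge Y v w ⊎ Edge Y w v

      near? : Decidable Near
      near? w = w ∈? ⁅ v ⁆ ⊎-dec edge? Y v w ⊎-dec edge? Y w v

      far? : Decidable (λ w → w ∈ Y × ¬ Near w)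
      far? w = w ∈? Y ×-dec ¬? (near? w)

      Y′ : Subset r
      Y′ = select far?

      v∉Y′ : v ∉ Y′
      v∉Y′ v∈Y′ = proj₂ (∈-select⁻ far? v∈Y′) (inj₁ (x∈⁅x⁆ v))

      Y′-rec : LargeIndependentSubset Y′
      Y′-rec = rec Y′ ((λ w∈Y′ → proj₁ (∈-select⁻ far? w∈Y′)) , v , v∈Y , v∉Y′)

      I′ : Subset r
      I′ = proj₁ Y′-rec

      I′⊆Y′ : I′ ⊆ Y′
      I′⊆Y′ = proj₁ (proj₂ Y′-rec)

      I′-independent : Independent I′
      I′-independent = proj₁ (proj₂ (proj₂ Y′-rec))

      ∣Y′∣≤ : ∣ Y′ ∣ ℕ.≤ suc d * ∣ I′ ∣
      ∣Y′∣≤ = proj₂ (proj₂ (proj₂ Y′-rec))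

      far : ∀ {w} → w ∈ I′ → w ∈ Y × ¬ Near w
      far w∈I′ = ∈-select⁻ far? (I′⊆Y′ w∈I′)

      I : Subset r
      I = I′ ∪ ⁅ v ⁆

      ∈I⁻ : ∀ {w} → w ∈ I → w ∈ I′ ⊎ w ≡ v
      ∈I⁻ w∈I with x∈p∪q⁻ I′ ⁅ v ⁆ w∈I
      ... | inj₁ w∈I′ = inj₁ w∈I′
      ... | inj₂ w∈⁅v⁆ = inj₂ (x∈⁅y⁆⇒x≡y v w∈⁅v⁆)

      I⊆Y : I ⊆ Y
      I⊆Y w∈I with ∈I⁻ w∈I
      ... | inj₁ w∈I′ = proj₁ (far w∈I′)
      ... | inj₂ refl = v∈Y

      independent : Independent I
      independent u∈I w∈I with ∈I⁻ u∈I | ∈I⁻ w∈I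
      ... | inj₁ u∈I′ | inj₁ w∈I′ = I′-independent u∈I′ w∈I′
      ... | inj₁ u∈I′ | inj₂ refl =
        λ u~v → proj₂ (far u∈I′) (inj₂ (inj₂ (proj₁ (far u∈I′) , v∈Y , u~v)))
      ... | inj₂ refl | inj₁ w∈I′ =
        λ v~w → proj₂ (far w∈I′) (inj₂ (inj₁ (v∈Y , proj₁ (far w∈I′) , v~w)))
      ... | inj₂ refl | inj₂ refl = ~-irrefl

      cover : ∀ {w} → w ∈ Y → w ∈ Y′ ⊎ Near w
      cover {w} w∈Y with near? w
      ... | yes near = inj₂ near
      ... | no ¬near = inj₁ (∈-select⁺ far? (w∈Y , ¬near))

      ∣Y∣≤ : ∣ Y ∣ ℕ.≤ ∣ Y′ ∣ + suc d
      ∣Y∣≤ = begin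
        ∣ Y ∣                                     ≡⟨ ∣p∣≡count Y ⟩
        count (_∈? Y)                             ≤⟨ count-⊎ (_∈? Y) (_∈? Y′) near? cover ⟩
        count (_∈? Y′) + count near?              ≤⟨ ℕ.+-monoʳ-≤ (count (_∈? Y′)) near-count ⟩
        count (_∈? Y′) + (count (_∈? ⁅ v ⁆) + degree Y v)
          ≡⟨ cong₂ (λ a b → a + (b + degree Y v)) (sym (∣p∣≡count Y′))
                   (trans (sym (∣p∣≡count ⁅ v ⁆)) (∣⁅x⁆∣≡1 v)) ⟩
        ∣ Y′ ∣ + suc (degree Y v)                 ≤⟨ ℕ.+-monoʳ-≤ ∣ Y′ ∣ (s≤s deg≤d) ⟩
        ∣ Y′ ∣ + suc d                            ∎
        where
        open ℕ.≤-Reasoning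
        edge-either? : Decidable (λ w → Edge Y v w ⊎ Edge Y w v)
        edge-either? w = edge? Y v w ⊎-dec edge? Y w v
        near-count : count near? ℕ.≤ count (_∈? ⁅ v ⁆) + degree Y v
        near-count = ℕ.≤-trans (count-⊎ near? (_∈? ⁅ v ⁆) edge-either? (λ near → near))
          (ℕ.+-monoʳ-≤ (count (_∈? ⁅ v ⁆))
                       (count-⊎ edge-either? (edge? Y v) (λ u → edge? Y u v) (λ near → near)))

      ∣I∣≥ : ∣ I′ ∣ + 1 ℕ.≤ ∣ I ∣
      ∣I∣≥ = begin
        ∣ I′ ∣ + 1
          ≡⟨ cong₂ _+_ (∣p∣≡count I′) (trans (sym (∣⁅x⁆∣≡1 v)) (∣p∣≡count ⁅ v ⁆)) ⟩
        count (_∈? I′) + count (_∈? ⁅ v ⁆)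
          ≤⟨ count-disjoint (_∈? I′) (_∈? ⁅ v ⁆) (_∈? I)
               (λ w∈I′ → x∈p∪q⁺ (inj₁ w∈I′)) (λ w∈⁅v⁆ → x∈p∪q⁺ (inj₂ w∈⁅v⁆))
               (λ w∈I′ w∈⁅v⁆ → v∉Y′ (subst (_∈ Y′) (x∈⁅y⁆⇒x≡y v w∈⁅v⁆) (I′⊆Y′ w∈I′))) ⟩
        count (_∈? I)                             ≡⟨ sym (∣p∣≡count I) ⟩
        ∣ I ∣                                     ∎
        where open ℕ.≤-Reasoning

      size : ∣ Y ∣ ℕ.≤ suc d * ∣ I ∣
      size = begin
        ∣ Y ∣                                     ≤⟨ ∣Y∣≤ ⟩
        ∣ Y′ ∣ + suc d                            ≤⟨ ℕ.+-monoˡ-≤ (suc d) ∣Y′∣≤ ⟩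
        suc d * ∣ I′ ∣ + suc d                    ≡⟨ cong (suc d * ∣ I′ ∣ +_) (sym (ℕ.*-identityʳ _)) ⟩
        suc d * ∣ I′ ∣ + suc d * 1                ≡⟨ sym (ℕ.*-distribˡ-+ (suc d) ∣ I′ ∣ 1) ⟩
        suc d * (∣ I′ ∣ + 1)                      ≤⟨ ℕ.*-monoʳ-≤ (suc d) ∣I∣≥ ⟩
        suc d * ∣ I ∣                             ∎
        where open ℕ.≤-Reasoning

    large-independent-subset : ∀ Y → LargeIndependentSubset Y
    large-independent-subset Y = greedy Y (⊂-wellFounded Y)
      where
      greedy : ∀ Y → Acc _⊂_ Y → LargeIndependentSubset Y
      greedy Y (acc smaller) with nonempty? Y
      ... | no empty = ∅ , (λ x∈∅ → ⊥-elim (∉⊥ x∈∅)) , (λ u∈∅ → ⊥-elim (∉⊥ u∈∅)) ,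
                       ℕ.≤-trans (ℕ.≤-reflexive (trans (cong ∣_∣ (Empty-unique empty)) (∣⊥∣≡0 r))) z≤n
      ... | yes nonempty with low-degree Y nonempty
      ...   | v , v∈Y , deg≤d = greedy-step Y v v∈Y deg≤d (λ Y′ Y′⊂Y → greedy Y′ (smaller Y′⊂Y))


module NonCrossingArcs {r : ℕ} {_⌢_ : Rel (Fin r) ℓ} (_⌢?_ : Decidable₂ _⌢_)
  (⌢⇒< : ∀ {a b} → a ⌢ b → a < b)
  (noncrossing : ∀ {a b c d} → a < c → c < b → b < d → a ⌢ b → c ⌢ d → ⊥)
  (Y : Subset r) (endpoints : ∀ {a b} → a ⌢ b → a ∈ Y × b ∈ Y) where

  LongestFrom : Rel (Fin r) ℓ
  LongestFrom a b = a ⌢ b × ∄[ b′ ] (b < b′ × a ⌢ b′)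

  LongestTo : Rel (Fin r) ℓ
  LongestTo a b = a ⌢ b × ∄[ a′ ] (a′ < a × a′ ⌢ b)

  longestFrom? : Decidable₂ LongestFrom
  longestFrom? a b = a ⌢? b ×-dec ¬? (any? (λ b′ → b <? b′ ×-dec a ⌢? b′))

  longestTo? : Decidable₂ LongestTo
  longestTo? a b = a ⌢? b ×-dec ¬? (any? (λ a′ → a′ <? a ×-dec a′ ⌢? b))

  longest : ∀ {a b} → a ⌢ b → LongestFrom a b ⊎ LongestTo a b
  longest {a} {b} a⌢b
    with any? (λ b′ → b <? b′ ×-dec a ⌢? b′) | any? (λ a′ → a′ <? a ×-dec a′ ⌢? b)
  ... | no ∄b′ | _      = inj₁ (a⌢b , ∄b′)
  ... | yes _  | no ∄a′ = inj₂ (a⌢b , ∄a′)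
  ... | yes (b′ , b<b′ , a⌢b′) | yes (a′ , a′<a , a′⌢b) =
    ⊥-elim (noncrossing a′<a (⌢⇒< a⌢b) b<b′ a′⌢b a⌢b′)

  longestFrom-unique : ∀ {a b b′} → LongestFrom a b → LongestFrom a b′ → b ≡ b′
  longestFrom-unique {b = b} {b′} (a⌢b , longest) (a⌢b′ , longest′) with <-cmp b b′
  ... | tri< b<b′ _ _ = ⊥-elim (longest (b′ , b<b′ , a⌢b′))
  ... | tri≈ _ b≡b′ _ = b≡b′
  ... | tri> _ _ b′<b = ⊥-elim (longest′ (b , b′<b , a⌢b))

  longestTo-unique : ∀ {a a′ b} → LongestTo a b → LongestTo a′ b → a ≡ a′
  longestTo-unique {a} {a′} (a⌢b , longest) (a′⌢b , longest′) with <-cmp a a′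
  ... | tri< a<a′ _ _ = ⊥-elim (longest′ (a , a<a′ , a⌢b))
  ... | tri≈ _ a≡a′ _ = a≡a′
  ... | tri> _ _ a′<a = ⊥-elim (longest (a′ , a′<a , a′⌢b))

  arcs≤2*∣Y∣ : ∑[ a < r ] count (a ⌢?_) ℕ.≤ 2 * ∣ Y ∣
  arcs≤2*∣Y∣ = begin
    sum (λ a → count (a ⌢?_))
      ≤⟨ ∑-mono-≤ _ _ (λ a → count-⊎ (a ⌢?_) (longestFrom? a) (longestTo? a) longest) ⟩
    sum (λ a → count (longestFrom? a) + count (longestTo? a))
      ≡⟨ ∑-distrib-+ (λ a → count (longestFrom? a)) (λ a → count (longestTo? a)) ⟩
    sum (λ a → count (longestFrom? a)) + sum (λ a → count (longestTo? a))
      ≡⟨ cong (sum (λ a → count (longestFrom? a)) +_) (∑-comm (λ a b → χ (longestTo? a b))) ⟩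
    sum (λ a → count (longestFrom? a)) + sum (λ b → count (λ a → longestTo? a b))
      ≤⟨ ℕ.+-mono-≤ (∑-mono-≤ _ _ from≤) (∑-mono-≤ _ _ to≤) ⟩
    count (_∈? Y) + count (_∈? Y)
      ≡⟨ cong₂ _+_ (sym (∣p∣≡count Y)) (trans (sym (∣p∣≡count Y)) (sym (ℕ.+-identityʳ ∣ Y ∣))) ⟩
    2 * ∣ Y ∣                                                                       ∎
    where
    open ℕ.≤-Reasoning
    from≤ : ∀ a → count (longestFrom? a) ℕ.≤ χ (a ∈? Y)
    from≤ a = count-unique≤χ (longestFrom? a) (a ∈? Y)
                (λ from → proj₁ (endpoints (proj₁ from))) longestFrom-unique
    to≤ : ∀ b → count (λ a → longestTo? a b) ℕ.≤ χ (b ∈? Y)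
    to≤ b = count-unique≤χ (λ a → longestTo? a b) (b ∈? Y)
              (λ to → proj₂ (endpoints (proj₁ to))) longestTo-unique

module CrossingClosed {r : ℕ} {_R_ : Rel (Fin r) ℓ} (_R?_ : Decidable₂ _R_)
  (R⇒< : ∀ {a b} → a R b → a < b)
  (R-cross : ∀ {i j k l} → i < j → j < k → k < l → i R k → j R l → j R k)
  (R-forbidden : ∀ {i j k l} → i < j → j < k → k < l → i R k → i R l → j R l → ⊥)
  where

  open Degeneracy _R?_

  module _ (Y : Subset r) where

    Consecutive : Fin r → Fin r → Fin r → Set ℓ
    Consecutive a b j = Edge Y a j × Edge Y b j × a < b × ∄[ c ] (a < c × c < b × Edge Y c j)

    consecutive? : ∀ a b j → Dec (Consecutive a b j)
    consecutive? a b j = edge? Y a j ×-dec edge? Y b j ×-dec a <? b ×-dec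
                 ¬? (any? (λ c → a <? c ×-dec c <? b ×-dec edge? Y c j))

    Last : Rel (Fin r) ℓ
    Last a j = Edge Y a j × ∄[ c ] (a < c × Edge Y c j)

    last? : Decidable₂ Last
    last? a j = edge? Y a j ×-dec ¬? (any? (λ c → a <? c ×-dec edge? Y c j))

    last-or-consecutive : ∀ {a j} → Edge Y a j → Last a j ⊎ ∃[ b ] Consecutive a b j
    last-or-consecutive {a} {j} a─j with any? (λ c → a <? c ×-dec edge? Y c j)
    ... | no none = inj₁ (a─j , none)
    ... | yes later with least (λ c → a <? c ×-dec edge? Y c j) later
    ...   | b , (a<b , b─j) , first =
      inj₂ (b , a─j , b─j , a<b , λ (c , a<c , c<b , c─j) → first c<b (a<c , c─j))

    last-unique : ∀ {a a′ j} → Last a j → Last a′ j → a ≡ a′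
    last-unique {a} {a′} (a─j , none) (a′─j , none′) with <-cmp a a′
    ... | tri< a<a′ _ _ = ⊥-elim (none (a′ , a<a′ , a′─j))
    ... | tri≈ _ a≡a′ _ = a≡a′
    ... | tri> _ _ a′<a = ⊥-elim (none′ (a , a′<a , a─j))

    consecutive-noncrossing : ∀ {a b c d j k} → a < c → c < b → b < d →
      Consecutive a b j → Consecutive c d k → ⊥
    consecutive-noncrossing {a} {b} {c} {d} {j} {k} a<c c<b b<d
      (a─j@(_ , j∈Y , aRj) , (b∈Y , _ , bRj) , _ , empty)
      (c─k@(c∈Y , k∈Y , cRk) , (_ , _ , dRk) , _ , empty′) with <-cmp j k
    ... | tri≈ _ refl _ = empty (c , a<c , c<b , c─k)
    ... | tri< j<k _ _ = empty (c , a<c , c<b , c∈Y , j∈Y , R-cross a<c c<j j<k aRj cRk)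
      where c<j = <-transᶠ c<b (R⇒< bRj)
    ... | tri> _ _ k<j = empty′ (b , c<b , b<d , b∈Y , k∈Y , R-cross c<b b<k k<j cRk bRj)
      where b<k = <-transᶠ b<d (R⇒< dRk)

    consecutive-target-unique : ∀ {a b j k} → Consecutive a b j → Consecutive a b k → j ≡ k
    consecutive-target-unique {j = j} {k}
      ((_ , _ , aRj) , (_ , _ , bRj) , a<b , _) ((_ , _ , aRk) , (_ , _ , bRk) , _ , _)
      with <-cmp j k
    ... | tri< j<k _ _ = ⊥-elim (R-forbidden a<b (R⇒< bRj) j<k aRj aRk bRk)
    ... | tri≈ _ j≡k _ = j≡k
    ... | tri> _ _ k<j = ⊥-elim (R-forbidden a<b (R⇒< bRk) k<j aRk aRj bRj)

    Arc : Rel (Fin r) ℓ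
    Arc a b = ∃[ j ] Consecutive a b j

    arc? : Decidable₂ Arc
    arc? a b = any? (consecutive? a b)

    open NonCrossingArcs arc? (λ (_ , _ , _ , a<b , _) → a<b)
      (λ a<c c<b b<d (_ , ab) (_ , cd) → consecutive-noncrossing a<c c<b b<d ab cd)
      Y (λ (_ , (a∈Y , _) , (b∈Y , _) , _) → a∈Y , b∈Y)

    in-degree≤ : ∀ j →
      count (λ a → edge? Y a j) ℕ.≤ χ (j ∈? Y) + ∑[ a < r ] count (λ b → consecutive? a b j)
    in-degree≤ j = begin
      count (λ a → edge? Y a j)
        ≤⟨ count-⊎ (λ a → edge? Y a j) (λ a → last? a j) (λ a → any? (λ b → consecutive? a b j))
                   last-or-consecutive ⟩
      count (λ a → last? a j) + count (λ a → any? (λ b → consecutive? a b j))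
        ≤⟨ ℕ.+-mono-≤ (count-unique≤χ (λ a → last? a j) (j ∈? Y) (λ ((_ , j∈Y , _) , _) → j∈Y) last-unique)
                      (∑-mono-≤ _ _ (λ a → χ-∃≤count (λ b → consecutive? a b j))) ⟩
      χ (j ∈? Y) + sum (λ a → count (λ b → consecutive? a b j))                      ∎
      where open ℕ.≤-Reasoning

    count-consecutive≤arc : ∀ a b → count (consecutive? a b) ℕ.≤ χ (arc? a b)
    count-consecutive≤arc a b =
      count-unique≤χ (consecutive? a b) (arc? a b) (λ abj → _ , abj) consecutive-target-unique

    edges≤3*∣Y∣ : edges Y ℕ.≤ 3 * ∣ Y ∣
    edges≤3*∣Y∣ = begin
      edges Y
        ≡⟨ ∑-comm (λ a j → χ (edge? Y a j)) ⟩
      sum (λ j → count (λ a → edge? Y a j))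
        ≤⟨ ∑-mono-≤ _ _ in-degree≤ ⟩
      sum (λ j → χ (j ∈? Y) + sum (λ a → count (λ b → consecutive? a b j)))
        ≡⟨ ∑-distrib-+ (λ j → χ (j ∈? Y)) (λ j → sum (λ a → count (λ b → consecutive? a b j))) ⟩
      count (_∈? Y) + sum (λ j → sum (λ a → count (λ b → consecutive? a b j)))
        ≡⟨ cong₂ _+_ (sym (∣p∣≡count Y)) regroup ⟩
      ∣ Y ∣ + sum (λ a → sum (λ b → count (consecutive? a b)))
        ≤⟨ ℕ.+-monoʳ-≤ ∣ Y ∣ (∑-mono-≤ _ _ (λ a → ∑-mono-≤ _ _ (count-consecutive≤arc a))) ⟩
      ∣ Y ∣ + sum (λ a → count (arc? a))
        ≤⟨ ℕ.+-monoʳ-≤ ∣ Y ∣ arcs≤2*∣Y∣ ⟩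
      3 * ∣ Y ∣                                                              ∎
      where
      open ℕ.≤-Reasoning
      regroup : sum (λ j → sum (λ a → count (λ b → consecutive? a b j)))
              ≡ sum (λ a → sum (λ b → count (consecutive? a b)))
      regroup = trans (∑-comm (λ j a → count (λ b → consecutive? a b j)))
                      (sum-cong-≗ (λ a → ∑-comm (λ j b → χ (consecutive? a b j))))

  large-independent-set : ∃[ I ] Independent I × r ℕ.≤ 7 * ∣ I ∣
  large-independent-set
    with I , _ , independent , ∣⊤∣≤7∣I∣ ←
           large-independent-subset (λ iRi → <-irreflᶠ refl (R⇒< iRi)) 6
             (λ Y → sparse⇒low-degree 3 Y (edges≤3*∣Y∣ Y)) ⊤
    = I , independent , subst (ℕ._≤ 7 * ∣ I ∣) (∣⊤∣≡n r) ∣⊤∣≤7∣I∣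


module _ {a} {A : Set a} {_∼_ : Rel A ℓ} (∼-refl : Reflexive _∼_) (∼-trans : Transitive _∼_)
         {r : ℕ} (f : Fin r → A) (step : ∀ i j → toℕ j ≡ suc (toℕ i) → f i ∼ f j) where

  chain-≤ : ∀ {i j} → i ≤ j → f i ∼ f j
  chain-≤ {i} {j} i≤j = along (toℕ j ℕ.∸ toℕ i) (sym (ℕ.m∸n+n≡m i≤j))
    where
    along : ∀ k {j} → toℕ j ≡ k + toℕ i → f i ∼ f j
    along zero    e with toℕ-injective e
    ... | refl = ∼-refl
    along (suc k) {suc j} e = ∼-trans (along k (trans (toℕ-inject₁ j) (ℕ.suc-injective e)))
                                      (step (inject₁ j) (suc j) (cong suc (sym (toℕ-inject₁ j))))

module _ {n : ℕ} where

  NewEdge : Graph n → Graph n → Set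
  NewEdge G H = ∃[ u ] ∃[ v ] adj H u v ≡ true × adj G u v ≡ false

  ⊆ᴳ-refl : Reflexive (_⊆ᴳ_ {n})
  ⊆ᴳ-refl u v uv = uv

  ⊆ᴳ-trans : Transitive (_⊆ᴳ_ {n})
  ⊆ᴳ-trans G⊆H H⊆K u v uv = H⊆K u v (G⊆H u v uv)

  adj⇒≢ : (G : Graph n) {u v : Fin n} → adj G u v ≡ true → u ≢ v
  adj⇒≢ G {u} uv refl with () ← trans (sym uv) (irrefl G u)

  ⊆ᴳ-false : {G H : Graph n} → G ⊆ᴳ H → ∀ {u v} → adj H u v ≡ false → adj G u v ≡ false
  ⊆ᴳ-false {G} {H} G⊆H {u} {v} Huv with adj G u v in Guv
  ... | false = refl
  ... | true with () ← trans (sym (G⊆H u v Guv)) Huv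

  ⊊ᴳ⇒NewEdge : {G H : Graph n} → G ⊊ᴳ H → NewEdge G H
  ⊊ᴳ⇒NewEdge {G} {H} (G⊆H , G≠H)
    with u , ¬∀v ← ¬∀⟶∃¬ n _ (λ u → all? (λ v → adj G u v ≟ᵇ adj H u v))
                          (λ ∀u → G≠H (λ u v → ∀u u v))
    with v , Guv≢Huv ← ¬∀⟶∃¬ n _ (λ v → adj G u v ≟ᵇ adj H u v) ¬∀v
    with adj G u v in Guv | adj H u v in Huv
  ... | false | true  = u , v , Huv , Guv
  ... | false | false = ⊥-elim (Guv≢Huv refl)
  ... | true  | _     = ⊥-elim (Guv≢Huv (trans (sym (G⊆H u v Guv)) Huv))

  ∖ᴳ⁺ : {x y : Bool} → x ≡ true → y ≡ false → x ∧ not y ≡ true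
  ∖ᴳ⁺ refl refl = refl

  ∖ᴳ⁻ : {x y : Bool} → x ∧ not y ≡ true → x ≡ true × y ≡ false
  ∖ᴳ⁻ {true} {false} _ = refl , refl

  isClique? : (E : EdgeSet n) → Dec (IsClique E)
  isClique? E = anySubset? λ S → 2 ℕ.≤? ∣ S ∣ ×-dec
    all? (λ u → all? (λ v → ¬? (u ≟ v) →-dec ((E u v ≟ᵇ true) ⇔-dec (u ∈? S ×-dec v ∈? S))))

  ∖ᴳ-clique-∈ : (G H : Graph n) (C : IsClique (H ∖ᴳ G)) {u v : Fin n} →
    adj H u v ≡ true → adj G u v ≡ false → u ∈ proj₁ C × v ∈ proj₁ C
  ∖ᴳ-clique-∈ G H (S , _ , spans) Huv Guv = Equivalence.to (spans _ _ (adj⇒≢ H Huv)) (∖ᴳ⁺ Huv Guv)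

  ∖ᴳ-clique-adj : (G H : Graph n) (C : IsClique (H ∖ᴳ G)) {u v : Fin n} →
    u ≢ v → u ∈ proj₁ C → v ∈ proj₁ C → adj H u v ≡ true × adj G u v ≡ false
  ∖ᴳ-clique-adj G H (S , _ , spans) u≢v u∈S v∈S = ∖ᴳ⁻ (Equivalence.from (spans _ _ u≢v) (u∈S , v∈S))

  ∖ᴳ-clique-cross : (Ga Gb Gc Gd : Graph n) → Ga ⊆ᴳ Gb → Gc ⊆ᴳ Gd → NewEdge Gb Gc →
    IsClique (Gc ∖ᴳ Ga) → IsClique (Gd ∖ᴳ Gb) → IsClique (Gc ∖ᴳ Gb)
  ∖ᴳ-clique-cross Ga Gb Gc Gd a⊆b c⊆d (u₀ , v₀ , Gc-u₀v₀ , Gb-u₀v₀) Cca@(S , _) Cdb@(T , _) =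
    S ∩ T ,
    2≤∣p∣ (proj₁ (to Gc-u₀v₀ Gb-u₀v₀)) (proj₂ (to Gc-u₀v₀ Gb-u₀v₀)) (adj⇒≢ Gc Gc-u₀v₀) ,
    λ u v u≢v → mk⇔ (λ e → let Gc-uv , Gb-uv = ∖ᴳ⁻ e in to Gc-uv Gb-uv)
                    (λ (u∈S∩T , v∈S∩T) → from u≢v (x∈p∩q⁻ S T u∈S∩T) (x∈p∩q⁻ S T v∈S∩T))
    where
    to : ∀ {u v} → adj Gc u v ≡ true → adj Gb u v ≡ false → u ∈ S ∩ T × v ∈ S ∩ T
    to Gc-uv Gb-uv =
      let u∈S , v∈S = ∖ᴳ-clique-∈ Ga Gc Cca Gc-uv (⊆ᴳ-false {Ga} {Gb} a⊆b Gb-uv)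
          u∈T , v∈T = ∖ᴳ-clique-∈ Gb Gd Cdb (c⊆d _ _ Gc-uv) Gb-uv
      in x∈p∩q⁺ (u∈S , u∈T) , x∈p∩q⁺ (v∈S , v∈T)
    from : ∀ {u v} → u ≢ v → u ∈ S × u ∈ T → v ∈ S × v ∈ T → (Gc ∖ᴳ Gb) u v ≡ true
    from u≢v (u∈S , u∈T) (v∈S , v∈T) =
      ∖ᴳ⁺ (proj₁ (∖ᴳ-clique-adj Ga Gc Cca u≢v u∈S v∈S))
          (proj₂ (∖ᴳ-clique-adj Gb Gd Cdb u≢v u∈T v∈T))

  one-outside : {P : Pred (Fin n) ℓ} (T : Subset n) {x y : Fin n} →
    P x → P y → ¬ (x ∈ T × y ∈ T) → ∃[ z ] P z × z ∉ T
  one-outside T {x} px py ¬both with x ∈? T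
  ... | no x∉T  = x , px , x∉T
  ... | yes x∈T = _ , py , λ y∈T → ¬both (x∈T , y∈T)

  ∖ᴳ-clique-forbidden : (Ga Gb Gc Gd : Graph n) → Ga ⊆ᴳ Gb → Gb ⊆ᴳ Gc → Gc ⊆ᴳ Gd →
    NewEdge Ga Gb → NewEdge Gc Gd →
    IsClique (Gc ∖ᴳ Ga) → IsClique (Gd ∖ᴳ Ga) → IsClique (Gd ∖ᴳ Gb) → ⊥
  -- From a new edge xy of Gb pick z ∈ S ∩ S′ outside T, from a new edge pq of Gd pick
  -- w ∈ S′ outside S; then wz ∈ Gd ∖ Ga lies either in Gc ∖ Ga or in Gd ∖ Gb.
  ∖ᴳ-clique-forbidden Ga Gb Gc Gd a⊆b b⊆c c⊆d (x , y , Gb-xy , Ga-xy) (p , q , Gd-pq , Gc-pq)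
                      Cca@(S , _) Cda@(S′ , _) Cdb@(T , _) =
    impossible
      (one-outside T (x∈S , x∈S′) (y∈S , y∈S′)
         (λ (x∈T , y∈T) → not-¬ Gb-xy (proj₂ (∖ᴳ-clique-adj Gb Gd Cdb (adj⇒≢ Gb Gb-xy) x∈T y∈T))))
      (one-outside S p∈S′ q∈S′
         (λ (p∈S , q∈S) → not-¬ (proj₁ (∖ᴳ-clique-adj Ga Gc Cca (adj⇒≢ Gd Gd-pq) p∈S q∈S)) Gc-pq))
    where
    x∈S×y∈S = ∖ᴳ-clique-∈ Ga Gc Cca (b⊆c _ _ Gb-xy) Ga-xy
    x∈S = proj₁ x∈S×y∈S
    y∈S = proj₂ x∈S×y∈S
    x∈S′×y∈S′ = ∖ᴳ-clique-∈ Ga Gd Cda (c⊆d _ _ (b⊆c _ _ Gb-xy)) Ga-xy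
    x∈S′ = proj₁ x∈S′×y∈S′
    y∈S′ = proj₂ x∈S′×y∈S′
    p∈S′×q∈S′ =
      ∖ᴳ-clique-∈ Ga Gd Cda Gd-pq (⊆ᴳ-false {Ga} {Gc} (⊆ᴳ-trans {Ga} {Gb} {Gc} a⊆b b⊆c) Gc-pq)
    p∈S′ = proj₁ p∈S′×q∈S′
    q∈S′ = proj₂ p∈S′×q∈S′

    impossible : (∃[ z ] (z ∈ S × z ∈ S′) × z ∉ T) → (∃[ w ] w ∈ S′ × w ∉ S) → ⊥
    impossible (z , (z∈S , z∈S′) , z∉T) (w , w∈S′ , w∉S)
      with Gd-wz , Ga-wz ← ∖ᴳ-clique-adj Ga Gd Cda (λ { refl → w∉S z∈S }) w∈S′ z∈S′
      with adj Gc w z in Gc-wz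
    ... | true  = w∉S (proj₁ (∖ᴳ-clique-∈ Ga Gc Cca Gc-wz Ga-wz))
    ... | false = z∉T (proj₂ (∖ᴳ-clique-∈ Gb Gd Cdb Gd-wz (⊆ᴳ-false {Gb} {Gc} b⊆c Gc-wz)))

module StrictChain {n r : ℕ} (G : Fin r → Graph n)
  (step : ∀ i j → toℕ j ≡ suc (toℕ i) → G i ⊊ᴳ G j) where

  ⊆ᴳ-mono : ∀ {i j} → i ≤ j → G i ⊆ᴳ G j
  ⊆ᴳ-mono = chain-≤ {_∼_ = _⊆ᴳ_ {n}} (λ {H} → ⊆ᴳ-refl {n} {H})
                    (λ {F} {H} {K} → ⊆ᴳ-trans {n} {F} {H} {K}) G (λ i j e → proj₁ (step i j e))

  new-edge : ∀ {i j} → i < j → NewEdge (G i) (G j)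
  new-edge {i} {suc j} i<j =
    let u , v , Huv , Guv = ⊊ᴳ⇒NewEdge {G = G (inject₁ j)} {H = G (suc j)}
                              (step (inject₁ j) (suc j) (cong suc (sym (toℕ-inject₁ j))))
    in u , v , Huv , ⊆ᴳ-false {G = G i} {H = G (inject₁ j)} (⊆ᴳ-mono (<⇒≤pred i<j)) Guv

  Linked : Rel (Fin r) 0ℓ
  Linked i j = i < j × IsClique (G j ∖ᴳ G i)

  linked? : Decidable₂ Linked
  linked? i j = i <? j ×-dec isClique? (G j ∖ᴳ G i)

  linked-cross : ∀ {i j k l} → i < j → j < k → k < l → Linked i k → Linked j l → Linked j k
  linked-cross {i} {j} {k} {l} i<j j<k k<l (_ , Cki) (_ , Clj) =
    j<k , ∖ᴳ-clique-cross (G i) (G j) (G k) (G l) (⊆ᴳ-mono (ℕ.<⇒≤ i<j)) (⊆ᴳ-mono (ℕ.<⇒≤ k<l))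
                          (new-edge j<k) Cki Clj

  linked-forbidden : ∀ {i j k l} → i < j → j < k → k < l → Linked i k → Linked i l → Linked j l → ⊥
  linked-forbidden {i} {j} {k} {l} i<j j<k k<l (_ , Cki) (_ , Cli) (_ , Clj) =
    ∖ᴳ-clique-forbidden (G i) (G j) (G k) (G l)
      (⊆ᴳ-mono (ℕ.<⇒≤ i<j)) (⊆ᴳ-mono (ℕ.<⇒≤ j<k)) (⊆ᴳ-mono (ℕ.<⇒≤ k<l))
      (new-edge i<j) (new-edge k<l) Cki Cli Clj

  open CrossingClosed linked? proj₁ linked-cross linked-forbidden public using (large-independent-set)

theorem1 : (n r : ℕ) (G : Fin r → Graph n) →
    (∀ (i j : Fin r) → toℕ j ≡ suc (toℕ i) → G i ⊊ᴳ G j) →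
    Σ (Subset r) λ A →
    (r ℕ.≤ 20 * ∣ A ∣) ×
    (∀ (i j : Fin r) → i ∈ A → j ∈ A → toℕ i ℕ.< toℕ j → ¬ IsClique (G j ∖ᴳ G i))
theorem1 n r G step =
  let I , independent , r≤7∣I∣ = large-independent-set
  in I , ℕ.≤-trans r≤7∣I∣ (ℕ.*-monoˡ-≤ ∣ I ∣ (ℕ.m≤m+n 7 13)) ,
     λ i j i∈I j∈I i<j clique → independent i∈I j∈I (i<j , clique)
  where open StrictChain G step
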